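{- Let $f_0(1)=f_0(2)=1$ and $f_0(n)=0$ for $n\ge3$, and let $f_m$, $c_m(n,k)$ be as in the context. Then: (i) for all integers $m\ge1$ and $1\le k\le n$, $c_m(n,k)$ equals the number of words of length $n-1$ over the alphabet $\{0,1,\ldots,m\}$ which have exactly $k-1$ letters equal to $m$ and in which all zeros are isolated (no two consecutive letters are both $0$); (ii) $c_1(n,k)=\binom{k}{n-k}$ for $1\le k\le n$; (iii) for $m>1$ and $1\le k\le\lceil n/2\rceil$, \[ c_m(n,k)=\sum_{j=\lceil n/2\rceil-k}^{n-k}(m-1)^{j}\binom{j+k-1}{k-1}\binom{j+k}{n-j-k}. \]
   Context: For $m\ge1$, $f_m$ is the $m$th invert transform of $f_0$: $f_m(0)=1$ and $f_m(n)=\sum_{i=1}^{n} f_{m-1}(i)\,f_m(n-i)$ for $n\ge1$. For $m\ge1$ and $0\le k\le n$: $c_m(0,0)=1$, $c_m(n,0)=0$ for $n\ge1$, and $c_m(n,k)=\sum_{i=1}^{n-k+1} f_{m-1}(i)\,c_m(n-i,k-1)$ for $1\le k\le n$. -}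

module Defs where

open import Data.Nat using (ℕ; zero; suc; _+_; _*_; _∸_)
open import Data.Fin using (Fin; fromℕ) renaming (zero to fzero)
open import Data.Fin.Properties using () renaming (_≟_ to _≟ᶠ_)
open import Data.Vec using (Vec; []; _∷_)
open import Data.List using (List; []; _∷_; [_]; map; concatMap; filter; length; allFin)
open import Data.Product using (_×_)
open import Data.Unit using (⊤)
open import Relation.Nullary using (¬_; Dec; yes; no)
open import Relation.Nullary.Decidable using (_×-dec_; ¬?)
open import Relation.Binary.PropositionalEquality using (_≡_)
open import Data.Nat.Properties using () renaming (_≟_ to _≟ℕ_)

sumLen : ℕ → ℕ → (ℕ → ℕ) → ℕ
sumLen lo zero    g = 0
sumLen lo (suc l) g = g lo + sumLen (suc lo) l g

-- Σ[ lo , hi ] g = ∑_{i=lo}^{hi} g i   (empty, i.e. 0, when hi < lo)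
Σ[_,_] : ℕ → ℕ → (ℕ → ℕ) → ℕ
Σ[ lo , hi ] g = sumLen lo (suc hi ∸ lo) g

-- f_0(1) = f_0(2) = 1, f_0(n) = 0 otherwise (f_0(0) is never used)
f₀ : ℕ → ℕ
f₀ 1 = 1
f₀ 2 = 1
f₀ _ = 0

-- fuel-based invert transform: invFuel g fuel n is correct whenever n ≤ fuel
-- F(0) = 1, F(n) = ∑_{i=1}^{n} g(i) F(n-i)
invFuel : (ℕ → ℕ) → ℕ → ℕ → ℕ
invFuel g _          zero    = 1
invFuel g zero       (suc n) = 0
invFuel g (suc fuel) (suc n) = Σ[ 1 , suc n ] (λ i → g i * invFuel g fuel (suc n ∸ i))

invert : (ℕ → ℕ) → ℕ → ℕ
invert g n = invFuel g n n

f : ℕ → ℕ → ℕ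
f zero    = f₀
f (suc m) = invert (f m)

-- c m n k  (meaningful for m ≥ 1, 0 ≤ k ≤ n)
c : ℕ → ℕ → ℕ → ℕ
c m zero    zero    = 1
c m (suc n) zero    = 0
c m n       (suc k) = Σ[ 1 , n ∸ k ] (λ i → f (m ∸ 1) i * c m (n ∸ i) k)

-- words over the alphabet {0,…,m} = Fin (suc m)
allWords : (m l : ℕ) → List (Vec (Fin (suc m)) l)
allWords m zero    = [ [] ]
allWords m (suc l) = concatMap (λ x → map (x ∷_) (allWords m l)) (allFin (suc m))

occ : ∀ {m l} → Fin (suc m) → Vec (Fin (suc m)) l → ℕ
occ a [] = 0
occ a (x ∷ w) with x ≟ᶠ a
... | yes _ = suc (occ a w)
... | no  _ = occ a w

ZerosIsolated : ∀ {m l} → Vec (Fin (suc m)) l → Set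
ZerosIsolated [] = ⊤
ZerosIsolated (x ∷ []) = ⊤
ZerosIsolated (x ∷ y ∷ w) = ¬ (x ≡ fzero × y ≡ fzero) × ZerosIsolated (y ∷ w)

zerosIsolated? : ∀ {m l} (w : Vec (Fin (suc m)) l) → Dec (ZerosIsolated w)
zerosIsolated? [] = yes _
zerosIsolated? (x ∷ []) = yes _
zerosIsolated? (x ∷ y ∷ w) = ¬? ((x ≟ᶠ fzero) ×-dec (y ≟ᶠ fzero)) ×-dec zerosIsolated? (y ∷ w)

numWords : ℕ → ℕ → ℕ → ℕ
numWords m n k =
  length (filter (λ w → (occ (fromℕ m) w ≟ℕ (k ∸ 1)) ×-dec zerosIsolated? w)
                 (allWords m (n ∸ 1)))

-- Read sequences as formal power series and put u = x + x², the series of f₀.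
-- The positive part g_m of f_m satisfies g_{m+1} = g_m (1 + g_{m+1}), hence
-- g_m = u/(1 − m u), i.e. g_m = u + m u g_m; and the k-th column of c_m is
-- g_{m-1}^k.  With a = m − 1 the columns therefore obey
--   C_0 = 1,   C_{k+1} = u C_k + a u C_{k+1},
-- which determines them.  Expanding (u/(1 − a u))^k = Σ_j a^j (k multichoose j) u^{j+k}
-- and [xⁿ] u^p = C(p, n − p) gives (ii) (a = 0) and (iii); for (i), counting words by
-- their first letter (0, m, or one of the m − 1 others) gives the same recurrence.
module Submission where

open import Defs
open import Data.Bool using (Bool; true; false)
open import Data.Fin using (Fin; fromℕ; inject₁) renaming (zero to fzero; suc to fsuc)
open import Data.Fin.Properties using (fromℕ≢inject₁) renaming (suc-injective to fsuc-injective; _≟_ to _≟ᶠ_)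
open import Data.List using (List; []; _∷_; _++_; map; concatMap; filter; length; allFin; tabulate)
open import Data.List.Properties using (filter-≐; filter-none; filter-++; length-++; map-cong; map-tabulate)
open import Data.List.Relation.Unary.All using (universal)
open import Data.Nat
open import Data.Nat.Combinatorics using (_C_; nCn≡1; nCk+nC[k+1]≡[n+1]C[k+1]; k>n⇒nCk≡0)
open import Data.Nat.Induction using (<-rec)
open import Data.Nat.ListAction using (sum)
open import Data.Nat.Properties
open import Algebra.Properties.CommutativeSemigroup +-commutativeSemigroup using () renaming (interchange to +-interchange)
open import Data.Nat.Tactic.RingSolver using (solve-∀)
open import Data.Product using (_×_; _,_; proj₁)
open import Data.Unit using (⊤; tt)
open import Data.Vec using (Vec; []; _∷_)
open import Function using (_∘_)
open import Relation.Binary.PropositionalEquality hiding ([_])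
open import Relation.Nullary using (Dec; yes; no; does; contradiction)
open import Relation.Nullary.Decidable using (_×-dec_; ¬?)
open import Relation.Unary using (Pred; Decidable)
open ≡-Reasoning

sumLen-cong : ∀ lo len {g h : ℕ → ℕ} → (∀ i → lo ≤ i → i < lo + len → g i ≡ h i) →
              sumLen lo len g ≡ sumLen lo len h
sumLen-cong lo zero      eq = refl
sumLen-cong lo (suc len) eq = cong₂ _+_ (eq lo ≤-refl (m<m+n lo z<s))
  (sumLen-cong (suc lo) len λ i lo<i i<end → eq i (<⇒≤ lo<i) (subst (i <_) (sym (+-suc lo len)) i<end))

sumLen-vanishing : ∀ lo len {g : ℕ → ℕ} → (∀ i → lo ≤ i → i < lo + len → g i ≡ 0) →
                   sumLen lo len g ≡ 0
sumLen-vanishing lo zero      eq = refl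
sumLen-vanishing lo (suc len) eq = cong₂ _+_ (eq lo ≤-refl (m<m+n lo z<s))
  (sumLen-vanishing (suc lo) len λ i lo<i i<end → eq i (<⇒≤ lo<i) (subst (i <_) (sym (+-suc lo len)) i<end))

sumLen-shift : ∀ lo len g → sumLen (suc lo) len g ≡ sumLen lo len (g ∘ suc)
sumLen-shift lo zero      g = refl
sumLen-shift lo (suc len) g = cong (g (suc lo) +_) (sumLen-shift (suc lo) len g)

sumLen-split : ∀ lo a b g → sumLen lo (a + b) g ≡ sumLen lo a g + sumLen (lo + a) b g
sumLen-split lo zero    b g = cong (λ l → sumLen l b g) (sym (+-identityʳ lo))
sumLen-split lo (suc a) b g = begin
  g lo + sumLen (suc lo) (a + b) g                         ≡⟨ cong (g lo +_) (sumLen-split (suc lo) a b g) ⟩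
  g lo + (sumLen (suc lo) a g + sumLen (suc lo + a) b g)   ≡⟨ +-assoc (g lo) _ _ ⟨
  g lo + sumLen (suc lo) a g + sumLen (suc lo + a) b g     ≡⟨ cong (λ l → g lo + sumLen (suc lo) a g + sumLen l b g) (+-suc lo a) ⟨
  g lo + sumLen (suc lo) a g + sumLen (lo + suc a) b g     ∎

sumLen-last : ∀ lo len g → sumLen lo (suc len) g ≡ sumLen lo len g + g (lo + len)
sumLen-last lo len g = begin
  sumLen lo (suc len) g                           ≡⟨ cong (λ l → sumLen lo l g) (+-comm 1 len) ⟩
  sumLen lo (len + 1) g                           ≡⟨ sumLen-split lo len 1 g ⟩
  sumLen lo len g + (g (lo + len) + 0)            ≡⟨ cong (sumLen lo len g +_) (+-identityʳ _) ⟩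
  sumLen lo len g + g (lo + len)                  ∎

sumLen-distrib-+ : ∀ lo len g h →
                   sumLen lo len (λ i → g i + h i) ≡ sumLen lo len g + sumLen lo len h
sumLen-distrib-+ lo zero      g h = refl
sumLen-distrib-+ lo (suc len) g h = begin
  g lo + h lo + sumLen (suc lo) len (λ i → g i + h i)
    ≡⟨ cong (g lo + h lo +_) (sumLen-distrib-+ (suc lo) len g h) ⟩
  g lo + h lo + (sumLen (suc lo) len g + sumLen (suc lo) len h)
    ≡⟨ +-interchange (g lo) (h lo) _ _ ⟩
  g lo + sumLen (suc lo) len g + (h lo + sumLen (suc lo) len h) ∎

sumLen-*ˡ : ∀ lo len s g → sumLen lo len (λ i → s * g i) ≡ s * sumLen lo len g
sumLen-*ˡ lo zero      s g = sym (*-zeroʳ s)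
sumLen-*ˡ lo (suc len) s g =
  trans (cong (s * g lo +_) (sumLen-*ˡ (suc lo) len s g)) (sym (*-distribˡ-+ s (g lo) _))

sumLen-restrict : ∀ lo len N {g : ℕ → ℕ} → lo + len ≤ N →
                  (∀ i → i < lo → g i ≡ 0) → (∀ i → lo + len ≤ i → i < N → g i ≡ 0) →
                  sumLen 0 N g ≡ sumLen lo len g
sumLen-restrict lo len N {g} fits below above = begin
  sumLen 0 N g                                   ≡⟨ cong (λ l → sumLen 0 l g) (sym N≡) ⟩
  sumLen 0 (lo + (len + rest)) g                 ≡⟨ sumLen-split 0 lo (len + rest) g ⟩
  sumLen 0 lo g + sumLen lo (len + rest) g       ≡⟨ cong₂ _+_ (sumLen-vanishing 0 lo (λ i _ → below i))
                                                              (sumLen-split lo len rest g) ⟩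
  sumLen lo len g + sumLen (lo + len) rest g     ≡⟨ cong (sumLen lo len g +_) (sumLen-vanishing (lo + len) rest
                                                      (λ i lo+len≤i i<N → above i lo+len≤i (subst (i <_) N≡′ i<N))) ⟩
  sumLen lo len g + 0                            ≡⟨ +-identityʳ _ ⟩
  sumLen lo len g                                ∎
  where
  rest : ℕ
  rest = N ∸ (lo + len)
  N≡′ : lo + len + rest ≡ N
  N≡′ = m+[n∸m]≡n fits
  N≡ : lo + (len + rest) ≡ N
  N≡ = trans (sym (+-assoc lo len rest)) N≡′

sumLen-pascal : ∀ N {first second w : ℕ → ℕ} → first 0 ≡ w 0 →
                (∀ j → first (suc j) + second j ≡ w (suc j)) → second N ≡ 0 →
                sumLen 0 (suc N) first + sumLen 0 (suc N) second ≡ sumLen 0 (suc N) w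
sumLen-pascal N {first} {second} {w} first0 step secondN = begin
  sumLen 0 (suc N) first + sumLen 0 (suc N) second
    ≡⟨ cong₂ _+_ (cong (first 0 +_) (sumLen-shift 0 N first))
                 (trans (sumLen-last 0 N second) (cong (sumLen 0 N second +_) secondN)) ⟩
  (first 0 + sumLen 0 N (first ∘ suc)) + (sumLen 0 N second + 0)
    ≡⟨ regroup (first 0) _ _ ⟩
  first 0 + (sumLen 0 N (first ∘ suc) + sumLen 0 N second)
    ≡⟨ cong₂ _+_ first0 (sym (sumLen-distrib-+ 0 N (first ∘ suc) second)) ⟩
  w 0 + sumLen 0 N (λ j → first (suc j) + second j)
    ≡⟨ cong (w 0 +_) (trans (sumLen-cong 0 N (λ j _ _ → step j)) (sym (sumLen-shift 0 N w))) ⟩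
  sumLen 0 (suc N) w ∎
  where
  regroup : ∀ x y z → (x + y) + (z + 0) ≡ x + (y + z)
  regroup = solve-∀

-- Sequences as formal power series

δ : ℕ → ℕ
δ zero    = 1
δ (suc _) = 0

shift : (ℕ → ℕ) → ℕ → ℕ
shift a zero    = 0
shift a (suc n) = a n

-- multiplication by u = x + x²
u· : (ℕ → ℕ) → ℕ → ℕ
u· a n = shift a n + shift (shift a) n

infixl 7 _⊛_

_⊛_ : (ℕ → ℕ) → (ℕ → ℕ) → ℕ → ℕ
(a ⊛ b) zero    = a 0 * b 0
(a ⊛ b) (suc n) = a 0 * b (suc n) + ((a ∘ suc) ⊛ b) n

⊛-cong : ∀ {a a′ b b′} → a ≗ a′ → b ≗ b′ → a ⊛ b ≗ a′ ⊛ b′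
⊛-cong ea eb zero    = cong₂ _*_ (ea 0) (eb 0)
⊛-cong ea eb (suc n) = cong₂ _+_ (cong₂ _*_ (ea 0) (eb (suc n))) (⊛-cong (ea ∘ suc) eb n)

⊛-distribʳ-+ : ∀ a a′ b → (λ i → a i + a′ i) ⊛ b ≗ λ n → (a ⊛ b) n + (a′ ⊛ b) n
⊛-distribʳ-+ a a′ b zero    = *-distribʳ-+ (b 0) (a 0) (a′ 0)
⊛-distribʳ-+ a a′ b (suc n) = begin
  (a 0 + a′ 0) * b (suc n) + ((λ i → a (suc i) + a′ (suc i)) ⊛ b) n
    ≡⟨ cong₂ _+_ (*-distribʳ-+ (b (suc n)) (a 0) (a′ 0)) (⊛-distribʳ-+ (a ∘ suc) (a′ ∘ suc) b n) ⟩
  a 0 * b (suc n) + a′ 0 * b (suc n) + (((a ∘ suc) ⊛ b) n + ((a′ ∘ suc) ⊛ b) n)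
    ≡⟨ +-interchange (a 0 * b (suc n)) (a′ 0 * b (suc n)) _ _ ⟩
  a 0 * b (suc n) + ((a ∘ suc) ⊛ b) n + (a′ 0 * b (suc n) + ((a′ ∘ suc) ⊛ b) n) ∎

⊛-*ˡ : ∀ s a b → (λ i → s * a i) ⊛ b ≗ λ n → s * (a ⊛ b) n
⊛-*ˡ s a b zero    = *-assoc s (a 0) (b 0)
⊛-*ˡ s a b (suc n) = trans (cong₂ _+_ (*-assoc s (a 0) (b (suc n))) (⊛-*ˡ s (a ∘ suc) b n))
                           (sym (*-distribˡ-+ s _ _))

shift-⊛ : ∀ a b → shift a ⊛ b ≗ shift (a ⊛ b)
shift-⊛ a b zero    = refl
shift-⊛ a b (suc n) = refl

⊛-zeroˡ : ∀ b → (λ _ → 0) ⊛ b ≗ λ _ → 0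
⊛-zeroˡ b zero    = refl
⊛-zeroˡ b (suc n) = ⊛-zeroˡ b n

⊛-identityˡ : ∀ b → δ ⊛ b ≗ b
⊛-identityˡ b zero    = +-identityʳ (b 0)
⊛-identityˡ b (suc n) = trans (cong₂ _+_ (+-identityʳ (b (suc n))) (⊛-zeroˡ b n)) (+-identityʳ _)

⊛-sumLen : ∀ a b n → (a ⊛ b) n ≡ sumLen 0 (suc n) (λ i → a i * b (n ∸ i))
⊛-sumLen a b zero    = sym (+-identityʳ _)
⊛-sumLen a b (suc n) = cong (a 0 * b (suc n) +_) (begin
  ((a ∘ suc) ⊛ b) n                                  ≡⟨ ⊛-sumLen (a ∘ suc) b n ⟩
  sumLen 0 (suc n) (λ i → a (suc i) * b (n ∸ i))     ≡⟨ sumLen-shift 0 (suc n) (λ i → a i * b (suc n ∸ i)) ⟨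
  sumLen 1 (suc n) (λ i → a i * b (suc n ∸ i))       ∎)

u·-local : ∀ {a b} n → (∀ q → q < n → a q ≡ b q) → u· a n ≡ u· b n
u·-local zero          eq = refl
u·-local (suc zero)    eq = cong (_+ 0) (eq 0 z<s)
u·-local (suc (suc n)) eq = cong₂ _+_ (eq (suc n) ≤-refl) (eq n (m<n⇒m<1+n (n<1+n n)))

u·-cong : ∀ {a b} → a ≗ b → u· a ≗ u· b
u·-cong eq n = u·-local n (λ q _ → eq q)

u·-+ : ∀ a b n → u· (λ i → a i + b i) n ≡ u· a n + u· b n
u·-+ a b zero          = refl
u·-+ a b (suc zero)    = spread (a 0) (b 0)
  where
  spread : ∀ x y → x + y + 0 ≡ x + 0 + (y + 0)
  spread = solve-∀
u·-+ a b (suc (suc n)) = +-interchange (a (suc n)) (b (suc n)) (a n) (b n)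

u·-*ˡ : ∀ s a n → u· (λ i → s * a i) n ≡ s * u· a n
u·-*ˡ s a zero          = sym (*-zeroʳ s)
u·-*ˡ s a (suc zero)    = trans (+-identityʳ _) (cong (s *_) (sym (+-identityʳ (a 0))))
u·-*ˡ s a (suc (suc n)) = sym (*-distribˡ-+ s (a (suc n)) (a n))

u·-sumLen : ∀ lo len (g : ℕ → ℕ → ℕ) n →
            u· (λ q → sumLen lo len (λ j → g j q)) n ≡ sumLen lo len (λ j → u· (g j) n)
u·-sumLen lo zero      g zero          = refl
u·-sumLen lo zero      g (suc zero)    = refl
u·-sumLen lo zero      g (suc (suc n)) = refl
u·-sumLen lo (suc len) g n = begin
  u· (λ q → g lo q + sumLen (suc lo) len (λ j → g j q)) n
    ≡⟨ u·-+ (g lo) (λ q → sumLen (suc lo) len (λ j → g j q)) n ⟩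
  u· (g lo) n + u· (λ q → sumLen (suc lo) len (λ j → g j q)) n
    ≡⟨ cong (u· (g lo) n +_) (u·-sumLen (suc lo) len g n) ⟩
  u· (g lo) n + sumLen (suc lo) len (λ j → u· (g j) n) ∎

u·-⊛ : ∀ a b → u· a ⊛ b ≗ u· (a ⊛ b)
u·-⊛ a b n = begin
  (u· a ⊛ b) n                                    ≡⟨ ⊛-distribʳ-+ (shift a) (shift (shift a)) b n ⟩
  (shift a ⊛ b) n + (shift (shift a) ⊛ b) n      ≡⟨ cong₂ _+_ (shift-⊛ a b n) (shift-⊛ (shift a) b n) ⟩
  shift (a ⊛ b) n + shift (shift a ⊛ b) n        ≡⟨ cong (shift (a ⊛ b) n +_) (shift-cong (shift-⊛ a b) n) ⟩
  u· (a ⊛ b) n                                    ∎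
  where
  shift-cong : ∀ {a b} → a ≗ b → shift a ≗ shift b
  shift-cong eq zero    = refl
  shift-cong eq (suc n) = eq n

-- the series u/(1 − s u), characterised by g = u + s u g
Geometric : ℕ → (ℕ → ℕ) → Set
Geometric s g = ∀ n → g n ≡ u· δ n + s * u· g n

geometric-⊛ : ∀ {s g} → Geometric s g → ∀ b → g ⊛ b ≗ λ n → u· b n + s * u· (g ⊛ b) n
geometric-⊛ {s} {g} geo b n = begin
  (g ⊛ b) n                                             ≡⟨ ⊛-cong geo (λ _ → refl) n ⟩
  ((λ i → u· δ i + s * u· g i) ⊛ b) n                   ≡⟨ ⊛-distribʳ-+ (u· δ) (λ i → s * u· g i) b n ⟩
  (u· δ ⊛ b) n + ((λ i → s * u· g i) ⊛ b) n             ≡⟨ cong₂ _+_ (u·-⊛ δ b n) (⊛-*ˡ s (u· g) b n) ⟩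
  u· (δ ⊛ b) n + s * (u· g ⊛ b) n                       ≡⟨ cong₂ (λ x y → x + s * y) (u·-cong (⊛-identityˡ b) n) (u·-⊛ g b n) ⟩
  u· b n + s * u· (g ⊛ b) n                             ∎

invFuel-fuel : ∀ g F F′ n → n ≤ F → n ≤ F′ → invFuel g F n ≡ invFuel g F′ n
invFuel-fuel g zero    zero     zero    _         _          = refl
invFuel-fuel g zero    (suc F′) zero    _         _          = refl
invFuel-fuel g (suc F) zero     zero    _         _          = refl
invFuel-fuel g (suc F) (suc F′) zero    _         _          = refl
invFuel-fuel g (suc F) (suc F′) (suc n) (s≤s n≤F) (s≤s n≤F′) =
  sumLen-cong 1 (suc n) λ { (suc i) _ _ →
    cong (g (suc i) *_) (invFuel-fuel g F F′ (n ∸ i) (≤-trans (m∸n≤m n i) n≤F) (≤-trans (m∸n≤m n i) n≤F′)) }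

-- f m without its constant term, which the invert transform never reads
f⁺ : ℕ → ℕ → ℕ
f⁺ m zero    = 0
f⁺ m (suc n) = f m (suc n)

f-f⁺ : ∀ m → f (suc m) ≗ λ n → f⁺ (suc m) n + δ n
f-f⁺ m zero    = refl
f-f⁺ m (suc n) = sym (+-identityʳ _)

f⁺-invert : ∀ m → f⁺ (suc m) ≗ f⁺ m ⊛ f (suc m)
f⁺-invert m zero    = refl
f⁺-invert m (suc n) = begin
  sumLen 1 (suc n) (λ i → f m i * invFuel (f m) n (suc n ∸ i))
    ≡⟨ sumLen-shift 0 (suc n) _ ⟩
  sumLen 0 (suc n) (λ i → f m (suc i) * invFuel (f m) n (n ∸ i))
    ≡⟨ sumLen-cong 0 (suc n) (λ i _ _ → cong (f m (suc i) *_) (invFuel-fuel (f m) n (n ∸ i) (n ∸ i) (m∸n≤m n i) ≤-refl)) ⟩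
  sumLen 0 (suc n) (λ i → f m (suc i) * f (suc m) (n ∸ i))
    ≡⟨ ⊛-sumLen (f⁺ m ∘ suc) (f (suc m)) n ⟨
  ((f⁺ m ∘ suc) ⊛ f (suc m)) n ∎

f⁺-geometric : ∀ m → Geometric m (f⁺ m)
f⁺-geometric zero    zero                = refl
f⁺-geometric zero    (suc zero)          = refl
f⁺-geometric zero    (suc (suc zero))    = refl
f⁺-geometric zero    (suc (suc (suc n))) = refl
f⁺-geometric (suc m) n = begin
  g n                                          ≡⟨ f⁺-invert m n ⟩
  (f⁺ m ⊛ F) n                                 ≡⟨ geometric-⊛ {m} (f⁺-geometric m) F n ⟩
  u· F n + m * u· (f⁺ m ⊛ F) n                 ≡⟨ cong₂ (λ x y → x + m * y)
                                                    (trans (u·-cong (f-f⁺ m) n) (u·-+ g δ n))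
                                                    (u·-cong (λ q → sym (f⁺-invert m q)) n) ⟩
  u· g n + u· δ n + m * u· g n                 ≡⟨ regroup (u· g n) (u· δ n) m ⟩
  u· δ n + suc m * u· g n                      ∎
  where
  g F : ℕ → ℕ
  g = f⁺ (suc m)
  F = f (suc m)
  regroup : ∀ x d m → x + d + m * x ≡ d + suc m * x
  regroup = solve-∀

column : ℕ → ℕ → ℕ → ℕ
column m k n = c m n k

column-zero : ∀ m → column m 0 ≗ δ
column-zero m zero    = refl
column-zero m (suc n) = refl

c-suc : ∀ m n k → c m n (suc k) ≡ Σ[ 1 , n ∸ k ] (λ i → f (m ∸ 1) i * c m (n ∸ i) k)
c-suc m zero    k = refl
c-suc m (suc n) k = refl

c-vanishing : ∀ m n k → n < k → c m n k ≡ 0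
c-vanishing m n (suc k) (s≤s n≤k) =
  trans (c-suc m n k) (cong (λ l → sumLen 1 l (λ i → f (m ∸ 1) i * c m (n ∸ i) k)) (m≤n⇒m∸n≡0 n≤k))

c-row-zero : ∀ m k → c m 0 k ≡ δ k
c-row-zero m zero    = refl
c-row-zero m (suc k) = c-vanishing m 0 (suc k) z<s

column-⊛ : ∀ a k → column (suc a) (suc k) ≗ f⁺ a ⊛ column (suc a) k
column-⊛ a k zero    = c-vanishing (suc a) 0 (suc k) z<s
column-⊛ a k (suc n) = begin
  sumLen 1 L (λ i → f a i * c (suc a) (suc n ∸ i) k)   ≡⟨ sumLen-shift 0 L _ ⟩
  sumLen 0 L h                                         ≡⟨ sumLen-restrict 0 L (suc n) (m∸n≤m (suc n) k) (λ _ ()) beyond ⟨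
  sumLen 0 (suc n) h                                   ≡⟨ ⊛-sumLen (f⁺ a ∘ suc) (column (suc a) k) n ⟨
  ((f⁺ a ∘ suc) ⊛ column (suc a) k) n                  ∎
  where
  L : ℕ
  L = suc n ∸ k
  h : ℕ → ℕ
  h i = f a (suc i) * c (suc a) (n ∸ i) k
  beyond : ∀ i → L ≤ i → i < suc n → h i ≡ 0
  beyond i L≤i (s≤s i≤n) = trans (cong (f a (suc i) *_) (c-vanishing (suc a) (n ∸ i) k n∸i<k)) (*-zeroʳ (f a (suc i)))
    where
    n<k+i : n < k + i
    n<k+i = ≤-trans (m≤n+m∸n (suc n) k) (+-monoʳ-≤ k L≤i)
    n∸i<k : n ∸ i < k
    n∸i<k = +-cancelʳ-< i (n ∸ i) k (subst (_< k + i) (sym (m∸n+n≡m i≤n)) n<k+i)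

column-recurrence : ∀ a k n →
  column (suc a) (suc k) n ≡ u· (column (suc a) k) n + a * u· (column (suc a) (suc k)) n
column-recurrence a k n = begin
  column (suc a) (suc k) n                              ≡⟨ column-⊛ a k n ⟩
  (f⁺ a ⊛ column (suc a) k) n                           ≡⟨ geometric-⊛ {a} (f⁺-geometric a) (column (suc a) k) n ⟩
  u· Ck n + a * u· (f⁺ a ⊛ Ck) n                        ≡⟨ cong (λ y → u· Ck n + a * y) (u·-cong (λ q → sym (column-⊛ a k q)) n) ⟩
  u· Ck n + a * u· (column (suc a) (suc k)) n           ∎
  where
  Ck : ℕ → ℕ
  Ck = column (suc a) k

-- X k is then the series (u/(1 − a u))^k, as far as its coefficients up to xᴺ go
Recurrent : ℕ → ℕ → (ℕ → ℕ → ℕ) → Set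
Recurrent a N X = (∀ n → X 0 n ≡ δ n)
                × (∀ k n → n ≤ N → X (suc k) n ≡ u· (X k) n + a * u· (X (suc k)) n)

recurrent-unique : ∀ {a N X Y} → Recurrent a N X → Recurrent a N Y → ∀ k n → n ≤ N → X k n ≡ Y k n
recurrent-unique (X0 , _) (Y0 , _) zero n _ = trans (X0 n) (sym (Y0 n))
recurrent-unique {a} {N} {X} {Y} rX@(_ , Xsuc) rY@(_ , Ysuc) (suc k) =
  <-rec (λ n → n ≤ N → X (suc k) n ≡ Y (suc k) n) step
  where
  step : ∀ n → (∀ {q} → q < n → q ≤ N → X (suc k) q ≡ Y (suc k) q) → n ≤ N → X (suc k) n ≡ Y (suc k) n
  step n IH n≤N = begin
    X (suc k) n                               ≡⟨ Xsuc k n n≤N ⟩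
    u· (X k) n + a * u· (X (suc k)) n         ≡⟨ cong₂ (λ x y → x + a * y)
                                                   (u·-local n (λ q q<n → recurrent-unique {a} rX rY k q (q≤N q<n)))
                                                   (u·-local n (λ q q<n → IH q<n (q≤N q<n))) ⟩
    u· (Y k) n + a * u· (Y (suc k)) n         ≡⟨ Ysuc k n n≤N ⟨
    Y (suc k) n                               ∎
    where
    q≤N : ∀ {q} → q < n → q ≤ N
    q≤N q<n = ≤-trans (<⇒≤ q<n) n≤N

column-recurrent : ∀ a N → Recurrent a N (column (suc a))
column-recurrent a N = column-zero (suc a) , λ k n _ → column-recurrence a k n

uPow : ℕ → ℕ → ℕ
uPow zero    = δ
uPow (suc k) = u· (uPow k)

uPow-vanishing : ∀ k n → n < k → uPow k n ≡ 0
uPow-vanishing (suc k) zero          _         = refl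
uPow-vanishing (suc k) (suc zero)    (s≤s 0<k) = trans (+-identityʳ _) (uPow-vanishing k zero 0<k)
uPow-vanishing (suc k) (suc (suc n)) (s≤s n<k) =
  cong₂ _+_ (uPow-vanishing k (suc n) n<k) (uPow-vanishing k n (<-trans (n<1+n n) n<k))

uPow-+ : ∀ k j → uPow k (k + j) ≡ k C j
uPow-+ zero    zero    = refl
uPow-+ zero    (suc j) = refl
uPow-+ (suc k) zero    = cong₂ _+_ (uPow-+ k 0) (shifted k)
  where
  shifted : ∀ k → shift (uPow k) (k + 0) ≡ 0
  shifted zero    = refl
  shifted (suc k) = uPow-vanishing (suc k) (k + 0) (s≤s (≤-reflexive (+-identityʳ k)))
uPow-+ (suc k) (suc j) = begin
  uPow k (k + suc j) + shift (uPow k) (k + suc j)     ≡⟨ cong (λ t → uPow k t + shift (uPow k) t) (+-suc k j) ⟩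
  uPow k (suc (k + j)) + uPow k (k + j)               ≡⟨ cong₂ _+_ (trans (cong (uPow k) (sym (+-suc k j))) (uPow-+ k (suc j)))
                                                                   (uPow-+ k j) ⟩
  k C suc j + k C j                                   ≡⟨ +-comm (k C suc j) _ ⟩
  k C j + k C suc j                                   ≡⟨ nCk+nC[k+1]≡[n+1]C[k+1] k j ⟩
  suc k C suc j                                       ∎

uPow-binomial : ∀ k n → k ≤ n → uPow k n ≡ k C (n ∸ k)
uPow-binomial k n k≤n = trans (cong (uPow k) (sym (m+[n∸m]≡n k≤n))) (uPow-+ k (n ∸ k))

uPow-vanishing-low : ∀ k n → k + k < n → uPow k n ≡ 0
uPow-vanishing-low k n k+k<n = trans (uPow-binomial k n k≤n) (k>n⇒nCk≡0 (m+n≤o⇒m≤o∸n (suc k) k+k<n))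
  where
  k≤n : k ≤ n
  k≤n = ≤-trans (m≤m+n k k) (<⇒≤ k+k<n)

uPow-recurrent : ∀ N → Recurrent 0 N uPow
uPow-recurrent N = (λ _ → refl) , λ k n _ → sym (+-identityʳ _)

column₁-binomial : ∀ n k → k ≤ n → c 1 n k ≡ k C (n ∸ k)
column₁-binomial n k k≤n =
  trans (recurrent-unique {0} (column-recurrent 0 n) (uPow-recurrent n) k n ≤-refl) (uPow-binomial k n k≤n)

-- The expansion of (u/(1 − a u))^k

-- multichoose k j is the coefficient of yʲ in (1 − y)^(−k)
multichoose : ℕ → ℕ → ℕ
multichoose zero    j = δ j
multichoose (suc k) j = (j + k) C k

multichoose-zero : ∀ k → multichoose k 0 ≡ 1
multichoose-zero zero    = refl
multichoose-zero (suc k) = nCn≡1 k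

multichoose-pascal : ∀ k j → multichoose (suc k) (suc j) ≡ multichoose k (suc j) + multichoose (suc k) j
multichoose-pascal zero    j = refl
multichoose-pascal (suc k) j = begin
  (suc j + suc k) C suc k                     ≡⟨ cong (λ t → suc t C suc k) (+-suc j k) ⟩
  suc (suc (j + k)) C suc k                   ≡⟨ nCk+nC[k+1]≡[n+1]C[k+1] (suc (j + k)) k ⟨
  suc (j + k) C k + suc (j + k) C suc k       ≡⟨ cong (λ t → suc (j + k) C k + t C suc k) (+-suc j k) ⟨
  (suc j + k) C k + (j + suc k) C suc k       ∎

expansion : ℕ → ℕ → ℕ → ℕ → ℕ
expansion a N k n = sumLen 0 (suc N) (λ j → a ^ j * multichoose k j * uPow (j + k) n)

u·-expansion : ∀ a N k n →
  u· (expansion a N k) n ≡ sumLen 0 (suc N) (λ j → a ^ j * multichoose k j * uPow (suc (j + k)) n)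
u·-expansion a N k n =
  trans (u·-sumLen 0 (suc N) (λ j q → a ^ j * multichoose k j * uPow (j + k) q) n)
        (sumLen-cong 0 (suc N) (λ j _ _ → u·-*ˡ (a ^ j * multichoose k j) (uPow (j + k)) n))

expansion-zero : ∀ a N n → expansion a N 0 n ≡ δ n
expansion-zero a N n = begin
  1 * 1 * uPow 0 n + sumLen 1 N (λ j → a ^ j * multichoose 0 j * uPow (j + 0) n)
    ≡⟨ cong₂ _+_ (+-identityʳ (δ n)) (sumLen-vanishing 1 N (λ { (suc j) _ _ → cong (_* uPow (suc j + 0) n) (*-zeroʳ (a ^ suc j)) })) ⟩
  δ n + 0 ≡⟨ +-identityʳ _ ⟩
  δ n ∎

expansion-suc : ∀ a N k n → n ≤ N →
  expansion a N (suc k) n ≡ u· (expansion a N k) n + a * u· (expansion a N (suc k)) n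
expansion-suc a N k n n≤N = sym (begin
  u· (expansion a N k) n + a * u· (expansion a N (suc k)) n
    ≡⟨ cong₂ (λ x y → x + a * y) (u·-expansion a N k n) (u·-expansion a N (suc k) n) ⟩
  sumLen 0 (suc N) first + a * sumLen 0 (suc N) (λ j → a ^ j * multichoose (suc k) j * uPow (suc (j + suc k)) n)
    ≡⟨ cong (sumLen 0 (suc N) first +_) (trans (sumLen-cong 0 (suc N) (λ j _ _ → reassoc a _ _ _)) (sumLen-*ˡ 0 (suc N) a _)) ⟨
  sumLen 0 (suc N) first + sumLen 0 (suc N) second
    ≡⟨ sumLen-pascal N {first} {second} first0 step secondN ⟩
  expansion a N (suc k) n ∎)
  where
  first second : ℕ → ℕ
  first  j = a ^ j * multichoose k j * uPow (suc (j + k)) n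
  second j = a ^ suc j * multichoose (suc k) j * uPow (suc (j + suc k)) n
  reassoc : ∀ a x y z → a * x * y * z ≡ a * (x * y * z)
  reassoc = solve-∀
  factor : ∀ x p q z → x * p * z + x * q * z ≡ x * (p + q) * z
  factor = solve-∀
  first0 : first 0 ≡ 1 * multichoose (suc k) 0 * uPow (suc k) n
  first0 = cong (λ t → 1 * t * uPow (suc k) n) (trans (multichoose-zero k) (sym (multichoose-zero (suc k))))
  step : ∀ j → first (suc j) + second j ≡ a ^ suc j * multichoose (suc k) (suc j) * uPow (suc j + suc k) n
  step j = begin
    first (suc j) + second j
      ≡⟨ cong (λ t → a ^ suc j * multichoose k (suc j) * uPow (suc t) n + second j) (sym (+-suc j k)) ⟩
    a ^ suc j * multichoose k (suc j) * X + a ^ suc j * multichoose (suc k) j * X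
      ≡⟨ factor (a ^ suc j) _ _ X ⟩
    a ^ suc j * (multichoose k (suc j) + multichoose (suc k) j) * X
      ≡⟨ cong (λ t → a ^ suc j * t * X) (multichoose-pascal k j) ⟨
    a ^ suc j * multichoose (suc k) (suc j) * X ∎
    where
    X : ℕ
    X = uPow (suc (j + suc k)) n
  secondN : second N ≡ 0
  secondN = trans (cong (a ^ suc N * multichoose (suc k) N *_)
                        (uPow-vanishing (suc (N + suc k)) n (s≤s (≤-trans n≤N (m≤m+n N (suc k))))))
                  (*-zeroʳ (a ^ suc N * multichoose (suc k) N))

expansion-recurrent : ∀ a N → Recurrent a N (expansion a N)
expansion-recurrent a N = expansion-zero a N , expansion-suc a N

m<⌈n/2⌉⇒m+m<n : ∀ m n → m < ⌈ n /2⌉ → m + m < n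
m<⌈n/2⌉⇒m+m<n zero    (suc n)       _         = z<s
m<⌈n/2⌉⇒m+m<n (suc m) (suc zero)    (s≤s ())
m<⌈n/2⌉⇒m+m<n (suc m) (suc (suc n)) (s≤s m<) =
  s≤s (subst (_< suc n) (sym (+-suc m m)) (s≤s (m<⌈n/2⌉⇒m+m<n m n m<)))

column-closedForm : ∀ a n k → 1 ≤ k → k ≤ ⌈ n /2⌉ →
  c (suc a) n k ≡ Σ[ ⌈ n /2⌉ ∸ k , n ∸ k ] (λ j → (a ^ j) * (((j + k) ∸ 1) C (k ∸ 1)) * ((j + k) C ((n ∸ j) ∸ k)))
column-closedForm a n k@(suc k′) _ k≤⌈n/2⌉ = begin
  c (suc a) n k          ≡⟨ recurrent-unique {a} (column-recurrent a n) (expansion-recurrent a n) k n ≤-refl ⟩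
  sumLen 0 (suc n) term  ≡⟨ sumLen-restrict lo len (suc n) (subst (_≤ suc n) (sym lo+len≡) (s≤s (m∸n≤m n k))) below above ⟩
  sumLen lo len term     ≡⟨ sumLen-cong lo len inRange ⟩
  sumLen lo len target   ∎
  where
  term target : ℕ → ℕ
  term   j = a ^ j * multichoose k j * uPow (j + k) n
  target j = (a ^ j) * (((j + k) ∸ 1) C k′) * ((j + k) C ((n ∸ j) ∸ k))
  lo len : ℕ
  lo  = ⌈ n /2⌉ ∸ k
  len = suc (n ∸ k) ∸ lo
  lo+len≡ : lo + len ≡ suc (n ∸ k)
  lo+len≡ = m+[n∸m]≡n (m≤n⇒m≤1+n (∸-monoˡ-≤ k (⌈n/2⌉≤n n)))
  below : ∀ j → j < lo → term j ≡ 0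
  below j j<lo = trans (cong (a ^ j * multichoose k j *_) (uPow-vanishing-low (j + k) n
                         (m<⌈n/2⌉⇒m+m<n (j + k) n (m≤o∸n⇒m+n≤o (suc j) k≤⌈n/2⌉ j<lo))))
                       (*-zeroʳ (a ^ j * multichoose k j))
  above : ∀ j → lo + len ≤ j → j < suc n → term j ≡ 0
  above j lo+len≤j _ = trans (cong (a ^ j * multichoose k j *_) (uPow-vanishing (j + k) n n<j+k)) (*-zeroʳ (a ^ j * multichoose k j))
    where
    n<j+k : n < j + k
    n<j+k = ≤-<-trans (m≤n+m∸n n k) (subst (k + (n ∸ k) <_) (+-comm k j)
                        (+-monoʳ-< k (subst (_≤ j) lo+len≡ lo+len≤j)))
  inRange : ∀ j → lo ≤ j → j < lo + len → term j ≡ target j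
  inRange j _ j<lo+len = cong₂ (λ x y → a ^ j * x * y)
    (cong (_C k′) (sym (cong (_∸ 1) (+-suc j k′))))
    (trans (uPow-binomial (j + k) n j+k≤n) (cong ((j + k) C_) (sym (∸-+-assoc n j k))))
    where
    j+k≤n : j + k ≤ n
    j+k≤n = m≤o∸n⇒m+n≤o j (≤-trans k≤⌈n/2⌉ (⌈n/2⌉≤n n)) (s≤s⁻¹ (subst (j <_) lo+len≡ j<lo+len))

-- Counting words

length-filter-map : ∀ {a p} {A B : Set a} {P : Pred B p} (P? : Decidable P) (g : A → B) xs →
                    length (filter P? (map g xs)) ≡ length (filter (P? ∘ g) xs)
length-filter-map P? g []       = refl
length-filter-map P? g (x ∷ xs) with does (P? (g x))
... | true  = cong suc (length-filter-map P? g xs)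
... | false = length-filter-map P? g xs

length-filter-concatMap : ∀ {a p} {A B : Set a} {P : Pred B p} (P? : Decidable P) (F : A → List B) xs →
  length (filter P? (concatMap F xs)) ≡ sum (map (λ x → length (filter P? (F x))) xs)
length-filter-concatMap P? F []       = refl
length-filter-concatMap P? F (x ∷ xs) = begin
  length (filter P? (F x ++ concatMap F xs))                  ≡⟨ cong length (filter-++ P? (F x) (concatMap F xs)) ⟩
  length (filter P? (F x) ++ filter P? (concatMap F xs))      ≡⟨ length-++ (filter P? (F x)) ⟩
  length (filter P? (F x)) + length (filter P? (concatMap F xs))
    ≡⟨ cong (length (filter P? (F x)) +_) (length-filter-concatMap P? F xs) ⟩
  length (filter P? (F x)) + sum (map (λ x → length (filter P? (F x))) xs) ∎

sum-tabulate-last : ∀ n (g : Fin (suc n) → ℕ) b → (∀ i → g (inject₁ i) ≡ b) →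
                    sum (tabulate g) ≡ n * b + g (fromℕ n)
sum-tabulate-last zero    g b _  = +-identityʳ (g fzero)
sum-tabulate-last (suc n) g b eq = begin
  g fzero + sum (tabulate (g ∘ fsuc))     ≡⟨ cong₂ _+_ (eq fzero) (sum-tabulate-last n (g ∘ fsuc) b (eq ∘ fsuc)) ⟩
  b + (n * b + g (fromℕ (suc n)))         ≡⟨ +-assoc b (n * b) _ ⟨
  suc n * b + g (fromℕ (suc n))           ∎

module WordCount (m′ : ℕ) where

  m : ℕ
  m = suc m′

  Word : ℕ → Set
  Word = Vec (Fin (suc m))

  M : Fin (suc m)
  M = fromℕ m

  NonzeroHeadIf : ∀ {l} → Bool → Word l → Set
  NonzeroHeadIf false w       = ⊤
  NonzeroHeadIf true  []      = ⊤
  NonzeroHeadIf true  (x ∷ w) = x ≢ fzero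

  nonzeroHeadIf? : ∀ {l} z (w : Word l) → Dec (NonzeroHeadIf z w)
  nonzeroHeadIf? false w       = yes tt
  nonzeroHeadIf? true  []      = yes tt
  nonzeroHeadIf? true  (x ∷ w) = ¬? (x ≟ᶠ fzero)

  Counted : ∀ {l} → ℕ → Bool → Word l → Set
  Counted j z w = (occ M w ≡ j × ZerosIsolated w) × NonzeroHeadIf z w

  counted? : ∀ {l} j z → Decidable (Counted {l} j z)
  counted? j z w = ((occ M w ≟ j) ×-dec zerosIsolated? w) ×-dec nonzeroHeadIf? z w

  -- count l j true is the number of words that may follow a 0
  count : ℕ → ℕ → Bool → ℕ
  count l j z = length (filter (counted? j z) (allWords m l))

  countFrom : ℕ → ℕ → Bool → Fin (suc m) → ℕ
  countFrom l j z x = length (filter (counted? j z ∘ (x ∷_)) (allWords m l))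

  afterZero : ℕ → ℕ → Bool → ℕ
  afterZero l j false = count l j true
  afterZero l j true  = 0

  afterM : ℕ → ℕ → ℕ
  afterM l zero    = 0
  afterM l (suc j) = count l j false

  occ-M : ∀ {l} (w : Word l) → occ M (M ∷ w) ≡ suc (occ M w)
  occ-M w with M ≟ᶠ M
  ... | yes _   = refl
  ... | no M≢M = contradiction refl M≢M

  occ-other : ∀ {l} x (w : Word l) → x ≢ M → occ M (x ∷ w) ≡ occ M w
  occ-other x w x≢M with x ≟ᶠ M
  ... | yes x≡M = contradiction x≡M x≢M
  ... | no _    = refl

  zerosIsolated-tail : ∀ {l} x (w : Word l) → ZerosIsolated (x ∷ w) → ZerosIsolated w
  zerosIsolated-tail x []      _       = tt
  zerosIsolated-tail x (y ∷ w) (_ , i) = i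

  zerosIsolated-cons : ∀ {l} x (w : Word l) → x ≢ fzero → ZerosIsolated w → ZerosIsolated (x ∷ w)
  zerosIsolated-cons x []      _   _ = tt
  zerosIsolated-cons x (y ∷ w) x≢0 i = (λ (x≡0 , _) → x≢0 x≡0) , i

  zerosIsolated-zero⁻ : ∀ {l} (w : Word l) → ZerosIsolated (fzero ∷ w) → NonzeroHeadIf true w
  zerosIsolated-zero⁻ []      _        = tt
  zerosIsolated-zero⁻ (y ∷ w) (¬00 , _) y≡0 = ¬00 (refl , y≡0)

  zerosIsolated-zero⁺ : ∀ {l} (w : Word l) → NonzeroHeadIf true w → ZerosIsolated w → ZerosIsolated (fzero ∷ w)
  zerosIsolated-zero⁺ []      _   _ = tt
  zerosIsolated-zero⁺ (y ∷ w) y≢0 i = (λ (_ , y≡0) → y≢0 y≡0) , i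

  nonzeroHeadIf-cons : ∀ {l} z x (w : Word l) → x ≢ fzero → NonzeroHeadIf z (x ∷ w)
  nonzeroHeadIf-cons false x w _   = tt
  nonzeroHeadIf-cons true  x w x≢0 = x≢0

  countFrom-zero : ∀ l j z → countFrom l j z fzero ≡ afterZero l j z
  countFrom-zero l j false = cong length (filter-≐ (counted? j false ∘ (fzero ∷_)) (counted? j true)
    ((λ { {w} ((o , i) , _) → (o , zerosIsolated-tail fzero w i) , zerosIsolated-zero⁻ w i })
    , (λ { {w} ((o , i) , h) → (o , zerosIsolated-zero⁺ w h i) , tt }))
    (allWords m l))
  countFrom-zero l j true  = cong length (filter-none (counted? j true ∘ (fzero ∷_))
    (universal (λ _ (_ , 0≢0) → 0≢0 refl) (allWords m l)))

  countFrom-M : ∀ l j z → countFrom l j z M ≡ afterM l j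
  countFrom-M l zero    z = cong length (filter-none (counted? zero z ∘ (M ∷_))
    (universal (λ w ((o , _) , _) → 1+n≢0 (trans (sym (occ-M w)) o)) (allWords m l)))
  countFrom-M l (suc j) z = cong length (filter-≐ (counted? (suc j) z ∘ (M ∷_)) (counted? j false)
    ((λ { {w} ((o , i) , _) → (suc-injective (trans (sym (occ-M w)) o) , zerosIsolated-tail M w i) , tt })
    , (λ { {w} ((o , i) , _) → (trans (occ-M w) (cong suc o) , zerosIsolated-cons M w (λ ()) i)
                              , nonzeroHeadIf-cons z M w (λ ()) }))
    (allWords m l))

  countFrom-other : ∀ l j z x → x ≢ fzero → x ≢ M → countFrom l j z x ≡ count l j false
  countFrom-other l j z x x≢0 x≢M = cong length (filter-≐ (counted? j z ∘ (x ∷_)) (counted? j false)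
    ((λ { {w} ((o , i) , _) → (trans (sym (occ-other x w x≢M)) o , zerosIsolated-tail x w i) , tt })
    , (λ { {w} ((o , i) , _) → (trans (occ-other x w x≢M) o , zerosIsolated-cons x w x≢0 i)
                              , nonzeroHeadIf-cons z x w x≢0 }))
    (allWords m l))

  -- split by the first letter: 0, the letter m, or one of the m′ = m − 1 others
  count-suc : ∀ l j z → count (suc l) j z ≡ afterZero l j z + (m′ * count l j false + afterM l j)
  count-suc l j z = begin
    count (suc l) j z
      ≡⟨ length-filter-concatMap (counted? j z) (λ x → map (x ∷_) (allWords m l)) (allFin (suc m)) ⟩
    sum (map (λ x → length (filter (counted? j z) (map (x ∷_) (allWords m l)))) (allFin (suc m)))
      ≡⟨ cong sum (map-cong (λ x → length-filter-map (counted? j z) (x ∷_) (allWords m l)) (allFin (suc m))) ⟩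
    sum (map (countFrom l j z) (allFin (suc m)))
      ≡⟨ cong sum (map-tabulate (λ x → x) (countFrom l j z)) ⟩
    countFrom l j z fzero + sum (tabulate (countFrom l j z ∘ fsuc))
      ≡⟨ cong₂ _+_ (countFrom-zero l j z) (sum-tabulate-last m′ (countFrom l j z ∘ fsuc) (count l j false) other) ⟩
    afterZero l j z + (m′ * count l j false + countFrom l j z M)
      ≡⟨ cong (λ t → afterZero l j z + (m′ * count l j false + t)) (countFrom-M l j z) ⟩
    afterZero l j z + (m′ * count l j false + afterM l j) ∎
    where
    other : ∀ i → countFrom l j z (fsuc (inject₁ i)) ≡ count l j false
    other i = countFrom-other l j z (fsuc (inject₁ i)) (λ ()) (λ eq → fromℕ≢inject₁ (sym (fsuc-injective eq)))

  count-nil : ∀ j z → count 0 j z ≡ δ j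
  count-nil zero    false = refl
  count-nil zero    true  = refl
  count-nil (suc j) false = refl
  count-nil (suc j) true  = refl

  numWords-count : ∀ l j → numWords m (suc l) (suc j) ≡ count l j false
  numWords-count l j = cong length (filter-≐ _ (counted? j false) ((_, tt) , proj₁) (allWords m l))

  mutual
    count-column : ∀ l j → count l j false ≡ c m (suc l) (suc j)
    count-column zero    j = begin
      count 0 j false                              ≡⟨ count-nil j false ⟩
      δ j                                          ≡⟨ pad (δ j) m′ ⟩
      (δ j + 0) + m′ * (δ (suc j) + 0)             ≡⟨ cong₂ (λ x y → (x + 0) + m′ * (y + 0)) (c-row-zero m j) (c-row-zero m (suc j)) ⟨
      (c m 0 j + 0) + m′ * (c m 0 (suc j) + 0)     ≡⟨ column-recurrence m′ j 1 ⟨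
      c m 1 (suc j)                                ∎
      where
      pad : ∀ d s → d ≡ (d + 0) + s * 0
      pad = solve-∀
    count-column (suc l) j = begin
      count (suc l) j false
        ≡⟨ count-suc l j false ⟩
      count l j true + (m′ * count l j false + afterM l j)
        ≡⟨ cong₂ _+_ (count-nonzeroHead l j)
                 (cong₂ (λ x y → m′ * x + y) (count-column l j) (afterM-column l j)) ⟩
      (c m l j + m′ * c m l (suc j)) + (m′ * c m (suc l) (suc j) + c m (suc l) j)
        ≡⟨ regroup (c m l j) (c m l (suc j)) m′ (c m (suc l) (suc j)) (c m (suc l) j) ⟩
      (c m (suc l) j + c m l j) + m′ * (c m (suc l) (suc j) + c m l (suc j))
        ≡⟨ column-recurrence m′ j (suc (suc l)) ⟨
      c m (suc (suc l)) (suc j) ∎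
      where
      regroup : ∀ a b s d e → (a + s * b) + (s * d + e) ≡ (e + a) + s * (d + b)
      regroup = solve-∀

    count-nonzeroHead : ∀ l j → count l j true ≡ c m l j + m′ * c m l (suc j)
    count-nonzeroHead zero    j = begin
      count 0 j true                   ≡⟨ count-nil j true ⟩
      δ j                              ≡⟨ pad (δ j) m′ ⟩
      δ j + m′ * δ (suc j)             ≡⟨ cong₂ (λ x y → x + m′ * y) (c-row-zero m j) (c-row-zero m (suc j)) ⟨
      c m 0 j + m′ * c m 0 (suc j)     ∎
      where
      pad : ∀ d s → d ≡ d + s * 0
      pad = solve-∀
    count-nonzeroHead (suc l) j = begin
      count (suc l) j true                           ≡⟨ count-suc l j true ⟩
      m′ * count l j false + afterM l j              ≡⟨ cong₂ (λ x y → m′ * x + y) (count-column l j) (afterM-column l j) ⟩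
      m′ * c m (suc l) (suc j) + c m (suc l) j       ≡⟨ +-comm (m′ * c m (suc l) (suc j)) _ ⟩
      c m (suc l) j + m′ * c m (suc l) (suc j)       ∎

    afterM-column : ∀ l j → afterM l j ≡ c m (suc l) j
    afterM-column l zero    = refl
    afterM-column l (suc j) = count-column l j

numWords-column : (m n k : ℕ) → 1 ≤ m → 1 ≤ k → k ≤ n → c m n k ≡ numWords m n k
numWords-column (suc m′) (suc l) (suc j) _ _ _ =
  sym (trans (WordCount.numWords-count m′ l j) (WordCount.count-column m′ l j))

corollary20 :
    ((m n k : ℕ) → 1 ≤ m → 1 ≤ k → k ≤ n → c m n k ≡ numWords m n k)
    × ((n k : ℕ) → 1 ≤ k → k ≤ n → c 1 n k ≡ k C (n ∸ k))
    × ((m n k : ℕ) → 1 < m → 1 ≤ k → k ≤ ⌈ n /2⌉ →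
         c m n k ≡ Σ[ ⌈ n /2⌉ ∸ k , n ∸ k ]
                     (λ j → ((m ∸ 1) ^ j) * (((j + k) ∸ 1) C (k ∸ 1)) * ((j + k) C ((n ∸ j) ∸ k))))
corollary20 =
  numWords-column ,
  (λ n k _ → column₁-binomial n k) ,
  λ { (suc a) n k _ → column-closedForm a n k }
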